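{- Let $n\ge 12$. Then there exists a $4$-uniform hypergraph $\mathcal{H}=(V,\mathcal{E})$ with $EI(\mathcal{H})=C_n$ and $|\mathcal{E}|=\lceil \frac{3}{4}n\rceil$. Consequently $\mu^4_n=\lceil\frac{3}{4}n\rceil$.
   Context: Hypergraphs $\mathcal{H}=(V,\mathcal{E})$ have no multiple hyperedges; isolated vertices are allowed. $\mathcal{H}$ is $k$-uniform if every hyperedge has exactly $k$ elements. The edge intersection hypergraph of $\mathcal{H}$ is $EI(\mathcal{H})=(V,\mathcal{E}^{EI})$ with $\mathcal{E}^{EI}=\{e_1\cap e_2: e_1,e_2\in\mathcal{E},\ e_1\ne e_2,\ |e_1\cap e_2|\ge 2\}$. $C_n$ is the cycle with vertex set $\{1,\dots,n\}$ and edges $\{i,i+1\}$, $i=1,\dots,n$ (indices mod $n$); "$EI(\mathcal{H})=C_n$" means $V=\{1,\dots,n\}$ and $\mathcal{E}^{EI}$ is exactly the edge set of $C_n$. $\mu^k_n$ is the minimum of $|\mathcal{E}|$ over all $k$-uniform $\mathcal{H}=(V,\mathcal{E})$ with $EI(\mathcal{H})=C_n$. -}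

module Defs where

open import Data.Nat using (ℕ; suc; _+_; _*_; _∸_; _≤_)
open import Data.Nat.DivMod using (_/_)
open import Data.Fin using (Fin; toℕ)
open import Data.Fin.Subset using (Subset; _∩_; _∪_; ⁅_⁆; ∣_∣)
open import Data.List using (List; length)
open import Data.List.Membership.Propositional renaming (_∈_ to _∈ˡ_)
open import Data.List.Relation.Unary.All using (All)
open import Data.List.Relation.Unary.Unique.Propositional using (Unique)
open import Data.Product using (Σ; ∃; _×_)
open import Data.Sum using (_⊎_)
open import Relation.Binary.PropositionalEquality using (_≡_; _≢_)
open import Relation.Nullary using (¬_)

-- A hypergraph on the vertex set Fin n (vertices 0..n-1 stand for 1..n):
-- its hyperedges form a duplicate-free list of subsets of Fin n.
record Hypergraph (n : ℕ) : Set where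
  constructor hypergraph
  field
    edges  : List (Subset n)
    unique : Unique edges
open Hypergraph public

numEdges : ∀ {n} → Hypergraph n → ℕ
numEdges H = length (edges H)

IsUniform : ∀ {n} → ℕ → Hypergraph n → Set
IsUniform k H = All (λ e → ∣ e ∣ ≡ k) (edges H)

InEI : ∀ {n} → Hypergraph n → Subset n → Set
InEI H s = Σ _ λ e₁ → Σ _ λ e₂ →
  e₁ ∈ˡ edges H × e₂ ∈ˡ edges H × e₁ ≢ e₂ × s ≡ e₁ ∩ e₂ × 2 ≤ ∣ s ∣

CycSucc : ∀ {n} → Fin n → Fin n → Set
CycSucc {n} i j = (toℕ j ≡ suc (toℕ i)) ⊎ (toℕ i ≡ n ∸ 1 × toℕ j ≡ 0)

CycleEdge : (n : ℕ) → Subset n → Set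
CycleEdge n s = Σ (Fin n) λ i → Σ (Fin n) λ j → CycSucc i j × s ≡ ⁅ i ⁆ ∪ ⁅ j ⁆

EIisCycle : ∀ {n} → Hypergraph n → Set
EIisCycle {n} H = ∀ s → (InEI H s → CycleEdge n s) × (CycleEdge n s → InEI H s)

MuIs : (k n m : ℕ) → Set
MuIs k n m =
  (Σ (Hypergraph n) λ H → IsUniform k H × EIisCycle H × numEdges H ≡ m)
  × (∀ (H : Hypergraph n) → IsUniform k H → EIisCycle H → m ≤ numEdges H)

ceil3n/4 : ℕ → ℕ
ceil3n/4 n = (3 * n + 3) / 4

-- Lower bound: every vertex v lies on two cycle edges, each the intersection of two
-- hyperedges through v, and the two pairs of hyperedges differ; so every vertex has
-- degree at least 3 and 3n ≤ Σ_v deg v = Σ_e |e| = 4|E|.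
--
-- Construction: cut the cycle at a seam between two windows of 4 vertices and insert
-- a copy of the windows at the seam. Each hyperedge l ∪ r crossing the seam is
-- replaced by l ∪ r′ and l′ ∪ r (primes denote the copy); all others keep their
-- vertices. This adds 4 vertices and 3 hyperedges and keeps EI(H) = C_n, provided
-- that inside the copy every r′ meets every l′ in at most an adjacent pair and every
-- adjacent pair of the copy arises this way. Explicit hypergraphs with such a seam
-- for n = 12, …, 15 then give all n ≥ 12.

module Submission where

open import Data.Bool.ListAction using (any)
open import Data.Bool.Properties using () renaming (_≟_ to _≟ᵇ_)
open import Data.Empty using (⊥; ⊥-elim)
open import Data.Fin.Base using (Fin; zero; suc; toℕ; fromℕ; inject₁; lower₁)
open import Data.Fin.Properties using (toℕ-fromℕ; toℕ-inject₁; toℕ-lower₁)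
open import Data.Fin.Subset using (Subset; Side; inside; outside; _∩_; _∪_; ⁅_⁆; ∣_∣)
  renaming (⊥ to ∅; _∈_ to _∈ˢ_)
open import Data.Fin.Subset.Properties
  using (∪-identityˡ; ∪-identityʳ; ∩-zeroˡ; ∩-zeroʳ; ∩-comm; ∣⊥∣≡0;
         x∈p∪q⁺; x∈p∪q⁻; x∈p∩q⁻; x∈⁅x⁆; x∈⁅y⁆⇒x≡y)
open import Data.List.Base using (List; []; _∷_; map; length) renaming (_++_ to _++ˡ_)
open import Data.List.Membership.Propositional using (_∈_; find)
open import Data.List.Membership.Propositional.Properties
  using (∈-map⁺; ∈-map⁻; ∈-++⁺ˡ; ∈-++⁺ʳ; ∈-++⁻)
open import Data.List.Properties using (length-map; length-++)
open import Data.List.Relation.Unary.All as All using (All; all?; []; _∷_)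
open import Data.List.Relation.Unary.All.Properties as All using ()
open import Data.List.Relation.Unary.AllPairs using (allPairs?)
open import Data.List.Relation.Unary.Any using (Any; any?; here; there)
open import Data.List.Relation.Unary.Unique.Propositional using (Unique)
import Data.List.Relation.Unary.Unique.Propositional.Properties as Unique
open import Data.Nat.Base using (ℕ; zero; suc; pred; _+_; _*_; _∸_; _≤_; s≤s; z≤n; _≡ᵇ_)
open import Data.Nat.Divisibility using (divides)
open import Data.Nat.DivMod using (_/_; +-distrib-/-∣ˡ; /-monoˡ-≤; m*n/n≡m)
open import Data.Nat.Properties
  using (_≤?_; _≟_; ≤-trans; ≤-reflexive; m≤n+m; +-mono-≤; +-monoˡ-≤; +-comm; +-assoc;
         +-identityʳ; *-comm; *-distribˡ-+; 1+n≢n; m+[n∸m]≡n; +-0-commutativeMonoid;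
         module ≤-Reasoning)
open import Algebra.Properties.CommutativeMonoid.Sum +-0-commutativeMonoid
  using (∑-distrib-+; sum-replicate-zero) renaming (sum to ∑)
open import Data.Product.Base using (Σ; ∃₂; _×_; _,_; proj₁; proj₂)
import Data.Product.Properties as Product
open import Data.Sum.Base using (_⊎_; inj₁; inj₂)
open import Data.Unit.Base using (⊤; tt)
open import Data.Vec.Base using ([]; _∷_; _++_; splitAt; tabulate; lookup)
open import Data.Vec.Properties using (++-injective; zipWith-++; []=⇒lookup)
import Data.Vec.Properties as Vec
open import Function.Base using (_∘_; _$_)
open import Relation.Binary.Definitions using (DecidableEquality)
open import Relation.Binary.PropositionalEquality
  using (_≡_; _≢_; refl; sym; trans; cong; cong₂; subst; module ≡-Reasoning)
open import Relation.Nullary using (¬_; Dec; yes; no; ¬?; _×-dec_; _⊎-dec_; _→-dec_)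
open import Relation.Nullary.Decidable using (from-yes; True; toWitness)

open import Defs

private
  variable
    k l m n : ℕ

-- For s ⊆ {0, …, n-1}: IsFirst s means s = {0}, IsLast s means s = {n-1},
-- Adjacent s means s = {i, i+1} and Wrapping s means s = {0, n-1}.

IsFirst : Subset n → Set
IsFirst []            = ⊥
IsFirst (inside ∷ s)  = s ≡ ∅
IsFirst (outside ∷ s) = ⊥

IsLast : Subset n → Set
IsLast []                 = ⊥
IsLast (inside ∷ [])      = ⊤
IsLast (inside ∷ _ ∷ _)   = ⊥
IsLast (outside ∷ s)      = IsLast s

Adjacent : Subset n → Set
Adjacent []            = ⊥
Adjacent (inside ∷ s)  = IsFirst s
Adjacent (outside ∷ s) = Adjacent s

Wrapping : Subset n → Set
Wrapping []            = ⊥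
Wrapping (inside ∷ s)  = IsLast s
Wrapping (outside ∷ s) = ⊥

CyclicAdjacent : Subset n → Set
CyclicAdjacent s = Adjacent s ⊎ Wrapping s

isLast-⁅⁆ : (i : Fin (suc n)) → toℕ i ≡ n → IsLast ⁅ i ⁆
isLast-⁅⁆ {zero}  zero    _  = tt
isLast-⁅⁆ {suc n} (suc i) eq = isLast-⁅⁆ i (cong pred eq)

isLast⇒⁅fromℕ⁆ : (s : Subset (suc n)) → IsLast s → s ≡ ⁅ fromℕ n ⁆
isLast⇒⁅fromℕ⁆ {zero}  (inside ∷ [])    _ = refl
isLast⇒⁅fromℕ⁆ {suc n} (outside ∷ s)    h = cong (outside ∷_) (isLast⇒⁅fromℕ⁆ s h)
isLast⇒⁅fromℕ⁆ {suc n} (inside ∷ _ ∷ _) ()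

adjacent-⁅⁆∪⁅⁆ : (i j : Fin n) → toℕ j ≡ suc (toℕ i) → Adjacent (⁅ i ⁆ ∪ ⁅ j ⁆)
adjacent-⁅⁆∪⁅⁆ zero    (suc zero) refl = ∪-identityˡ ∅
adjacent-⁅⁆∪⁅⁆ (suc i) (suc j)    eq   = adjacent-⁅⁆∪⁅⁆ i j (cong pred eq)

wrapping-⁅⁆∪⁅⁆ : (i j : Fin (suc (suc n))) → toℕ i ≡ suc n → toℕ j ≡ 0 →
                 Wrapping (⁅ i ⁆ ∪ ⁅ j ⁆)
wrapping-⁅⁆∪⁅⁆ (suc i) zero eq refl =
  subst IsLast (sym (∪-identityʳ ⁅ i ⁆)) (isLast-⁅⁆ i (cong pred eq))

cycleEdge⇒cyclicAdjacent : ∀ {s} → 2 ≤ n → CycleEdge n s → CyclicAdjacent s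
cycleEdge⇒cyclicAdjacent _ (i , j , inj₁ eq , refl) = inj₁ (adjacent-⁅⁆∪⁅⁆ i j eq)
cycleEdge⇒cyclicAdjacent (s≤s (s≤s _)) (i , j , inj₂ (eqᵢ , eqⱼ) , refl) =
  inj₂ (wrapping-⁅⁆∪⁅⁆ i j eqᵢ eqⱼ)

adjacent⇒⁅⁆∪⁅⁆ : (s : Subset n) → Adjacent s →
                 ∃₂ λ i j → toℕ j ≡ suc (toℕ i) × s ≡ ⁅ i ⁆ ∪ ⁅ j ⁆
adjacent⇒⁅⁆∪⁅⁆ (inside ∷ inside ∷ s) refl =
  zero , suc zero , refl , cong (λ t → inside ∷ inside ∷ t) (sym (∪-identityˡ ∅))
adjacent⇒⁅⁆∪⁅⁆ (outside ∷ s) h with adjacent⇒⁅⁆∪⁅⁆ s h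
... | i , j , eq , refl = suc i , suc j , cong suc eq , refl

cyclicAdjacent⇒cycleEdge : (s : Subset n) → CyclicAdjacent s → CycleEdge n s
cyclicAdjacent⇒cycleEdge s (inj₁ h) with adjacent⇒⁅⁆∪⁅⁆ s h
... | i , j , eq , s≡ = i , j , inj₁ eq , s≡
cyclicAdjacent⇒cycleEdge (inside ∷ s@(_ ∷ _)) (inj₂ h) =
  suc (fromℕ _) , zero , inj₂ (cong suc (toℕ-fromℕ _) , refl) ,
  cong (inside ∷_) (trans (isLast⇒⁅fromℕ⁆ s h) (sym (∪-identityʳ _)))

∣isFirst∣ : (s : Subset n) → IsFirst s → ∣ s ∣ ≡ 1
∣isFirst∣ {suc n} (inside ∷ s) refl = cong suc (∣⊥∣≡0 n)

∣isLast∣ : (s : Subset n) → IsLast s → ∣ s ∣ ≡ 1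
∣isLast∣ (inside ∷ [])  _ = refl
∣isLast∣ (outside ∷ s) h = ∣isLast∣ s h

∣cyclicAdjacent∣ : (s : Subset n) → CyclicAdjacent s → ∣ s ∣ ≡ 2
∣cyclicAdjacent∣ (inside ∷ s)  (inj₁ h) = cong suc (∣isFirst∣ s h)
∣cyclicAdjacent∣ (outside ∷ s) (inj₁ h) = ∣cyclicAdjacent∣ s (inj₁ h)
∣cyclicAdjacent∣ (inside ∷ s)  (inj₂ h) = cong suc (∣isLast∣ s h)

∅++∅ : ∀ k → ∅ {k} ++ ∅ {l} ≡ ∅
∅++∅ zero    = refl
∅++∅ (suc k) = cong (outside ∷_) (∅++∅ k)

++≡∅⁻ : (a : Subset k) {b : Subset l} → a ++ b ≡ ∅ → a ≡ ∅ × b ≡ ∅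
++≡∅⁻ {k} a eq = ++-injective a ∅ (trans eq (sym (∅++∅ k)))

isFirst-++∅ : (a : Subset k) {b : Subset l} → IsFirst a → b ≡ ∅ → IsFirst (a ++ b)
isFirst-++∅ {suc k} (inside ∷ a) refl refl = ∅++∅ k

isFirst-++⁻ : (a : Subset (suc k)) {b : Subset l} → IsFirst (a ++ b) → IsFirst a × b ≡ ∅
isFirst-++⁻ (inside ∷ a) h = ++≡∅⁻ a h

¬adjacent-∅ : ∀ k → ¬ Adjacent (∅ {k})
¬adjacent-∅ (suc k) h = ¬adjacent-∅ k h

¬isLast-∅ : ∀ k → ¬ IsLast (∅ {k})
¬isLast-∅ (suc k) h = ¬isLast-∅ k h

isLast-∅++ : ∀ k (b : Subset l) → IsLast b → IsLast (∅ {k} ++ b)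
isLast-∅++ zero    b h = h
isLast-∅++ (suc k) b h = isLast-∅++ k b h

isLast-++⁻ : (a : Subset k) (b : Subset (suc l)) → IsLast (a ++ b) → a ≡ ∅ × IsLast b
isLast-++⁻ []                b             h = refl , h
isLast-++⁻ (outside ∷ a)     b             h with isLast-++⁻ a b h
... | refl , h′ = refl , h′
isLast-++⁻ (inside ∷ [])     (_ ∷ _)       ()
isLast-++⁻ (inside ∷ _ ∷ _)  _             ()

adjacent-++∅ : (a : Subset k) {b : Subset l} → Adjacent a → b ≡ ∅ → Adjacent (a ++ b)
adjacent-++∅ (inside ∷ a)  h b≡∅ = isFirst-++∅ a h b≡∅
adjacent-++∅ (outside ∷ a) h b≡∅ = adjacent-++∅ a h b≡∅

adjacent-∅++ : ∀ k (b : Subset l) → Adjacent b → Adjacent (∅ {k} ++ b)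
adjacent-∅++ zero    b h = h
adjacent-∅++ (suc k) b h = adjacent-∅++ k b h

adjacent-∅++⁻ : ∀ k (b : Subset l) → Adjacent (∅ {k} ++ b) → Adjacent b
adjacent-∅++⁻ zero    b h = h
adjacent-∅++⁻ (suc k) b h = adjacent-∅++⁻ k b h

adjacent-++⁺ : (a : Subset k) {b : Subset l} → IsLast a → IsFirst b → Adjacent (a ++ b)
adjacent-++⁺ (inside ∷ [])  _ h = h
adjacent-++⁺ (outside ∷ a)  hₐ h = adjacent-++⁺ a hₐ h

adjacent-++⁻ : (a : Subset k) {b : Subset l} → Adjacent (a ++ b) →
               (Adjacent a × b ≡ ∅) ⊎ (a ≡ ∅ × Adjacent b) ⊎ (IsLast a × IsFirst b)
adjacent-++⁻ [] h = inj₂ (inj₁ (refl , h))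
adjacent-++⁻ (inside ∷ [])      h = inj₂ (inj₂ (tt , h))
adjacent-++⁻ (inside ∷ a@(_ ∷ _)) h = inj₁ (isFirst-++⁻ a h)
adjacent-++⁻ (outside ∷ a) h with adjacent-++⁻ a h
... | inj₁ p                = inj₁ p
... | inj₂ (inj₁ (refl , q)) = inj₂ (inj₁ (refl , q))
... | inj₂ (inj₂ p)         = inj₂ (inj₂ p)

wrapping-++⁻ : (a : Subset (suc k)) (b : Subset (suc l)) → Wrapping (a ++ b) →
               IsFirst a × IsLast b
wrapping-++⁻ (inside ∷ a) b h with isLast-++⁻ a b h
... | refl , h′ = refl , h′

∣++∣ : (a : Subset k) (b : Subset l) → ∣ a ++ b ∣ ≡ ∣ a ∣ + ∣ b ∣
∣++∣ []            b = refl
∣++∣ (inside ∷ a)  b = cong suc (∣++∣ a b)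
∣++∣ (outside ∷ a) b = ∣++∣ a b

∩-++ : (a c : Subset k) (b d : Subset l) → (a ++ b) ∩ (c ++ d) ≡ (a ∩ c) ++ (b ∩ d)
∩-++ a c b d = zipWith-++ _ a b c d

∣∅++∣ : ∀ k (s : Subset l) → ∣ ∅ {k} ++ s ∣ ≡ ∣ s ∣
∣∅++∣ zero    s = refl
∣∅++∣ (suc k) s = ∣∅++∣ k s

∣++∅∣ : (s : Subset k) → ∣ s ++ ∅ {l} ∣ ≡ ∣ s ∣
∣++∅∣ {l = l} []    = ∣⊥∣≡0 l
∣++∅∣ (inside ∷ s)  = cong suc (∣++∅∣ s)
∣++∅∣ (outside ∷ s) = ∣++∅∣ s

-- Cutting the cycle at a seam

-- A vertex set of the cycle, cut into a left window x, a right window y (the seam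
-- lies between them) and the rest z of the cycle.

Split : ℕ → ℕ → Set
Split w m = Subset (suc w) × Subset (suc w) × Subset (suc m)

private
  variable
    w : ℕ
    σ τ : Split w m

join : Split w m → Subset (suc w + (suc w + suc m))
join (x , y , z) = x ++ (y ++ z)

split : (s : Subset (suc w + (suc w + suc m))) → Σ (Split w m) λ σ → s ≡ join σ
split {w} s with splitAt (suc w) s
... | x , t , refl with splitAt (suc w) t
... | y , z , refl = (x , y , z) , refl

_⊓_ : Split w m → Split w m → Split w m
(x , y , z) ⊓ (x′ , y′ , z′) = x ∩ x′ , y ∩ y′ , z ∩ z′

split-cong : ∀ {x x′ y y′ : Subset (suc w)} {z z′ : Subset (suc m)} →
             x ≡ x′ → y ≡ y′ → z ≡ z′ → (x , y , z) ≡ (x′ , y′ , z′)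
split-cong refl refl refl = refl

join-∩ : (σ τ : Split w m) → join σ ∩ join τ ≡ join (σ ⊓ τ)
join-∩ (x , y , z) (x′ , y′ , z′) =
  trans (∩-++ x x′ (y ++ z) (y′ ++ z′)) (cong ((x ∩ x′) ++_) (∩-++ y y′ z z′))

join-injective : join σ ≡ join τ → σ ≡ τ
join-injective {σ = x , y , z} {τ = x′ , y′ , z′} eq with ++-injective x x′ eq
... | refl , eq′ with ++-injective y y′ eq′
... | refl , refl = refl

⊓-comm : (σ τ : Split w m) → σ ⊓ τ ≡ τ ⊓ σ
⊓-comm (x , y , z) (x′ , y′ , z′) = split-cong (∩-comm x x′) (∩-comm y y′) (∩-comm z z′)

SmallOrAdjacent : Subset n → Set
SmallOrAdjacent s = 2 ≤ ∣ s ∣ → CyclicAdjacent s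

SoundOn : List (Split w m) → Set
SoundOn L = ∀ {σ τ} → σ ∈ L → τ ∈ L → σ ≢ τ → SmallOrAdjacent (join (σ ⊓ τ))

Realised : List (Split w m) → Subset (suc w + (suc w + suc m)) → Set
Realised L s = ∃₂ λ σ τ → σ ∈ L × τ ∈ L × σ ≢ τ × s ≡ join (σ ⊓ τ)

CompleteOn : List (Split w m) → Set
CompleteOn L = ∀ {s} → CyclicAdjacent s → Realised L s

eiIsCycle : {L : List (Split w m)} (u : Unique (map join L)) → SoundOn L → CompleteOn L →
            EIisCycle (hypergraph (map join L) u)
eiIsCycle {w} {m} {L} u sound complete s = to , from
  where
  H = hypergraph (map join L) u
  to : InEI H s → CycleEdge _ s
  to (e₁ , e₂ , e₁∈ , e₂∈ , ne , refl , two) with ∈-map⁻ join e₁∈ | ∈-map⁻ join e₂∈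
  ... | σ , σ∈ , refl | τ , τ∈ , refl =
    cyclicAdjacent⇒cycleEdge _ (subst CyclicAdjacent (sym (join-∩ σ τ))
      (sound σ∈ τ∈ (ne ∘ cong join) (subst (λ t → 2 ≤ ∣ t ∣) (join-∩ σ τ) two)))
  from : CycleEdge _ s → InEI H s
  from c with cycleEdge⇒cyclicAdjacent (s≤s (≤-trans (s≤s z≤n) (m≤n+m _ w))) c
  ... | h with complete h
  ... | σ , τ , σ∈ , τ∈ , ne , eq =
    join σ , join τ , ∈-map⁺ join σ∈ , ∈-map⁺ join τ∈ , ne ∘ join-injective ,
    trans eq (sym (join-∩ σ τ)) , ≤-reflexive (sym (∣cyclicAdjacent∣ s h))

-- Inserting a block at the seam

data AvoidsWindow {w m} : Split w m → Set where
  avoidsLeft  : ∀ {y z} → AvoidsWindow (∅ , y , z)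
  avoidsRight : ∀ {x z} → AvoidsWindow (x , ∅ , z)

insert : Split w m → Split w (w + suc m)
insert (x , y , z) = x , ∅ , y ++ z

cyclicAdjacent-insert : AvoidsWindow σ → CyclicAdjacent (join σ) →
                        CyclicAdjacent (join (insert σ))
cyclicAdjacent-insert {w} (avoidsLeft {y} {z}) (inj₁ h) =
  inj₁ (adjacent-∅++ (suc w) _ (adjacent-∅++ (suc w) _ (adjacent-∅++⁻ (suc w) (y ++ z) h)))
cyclicAdjacent-insert {w} (avoidsRight {x} {z}) (inj₁ h) with adjacent-++⁻ x h
... | inj₁ (hₓ , e) = inj₁ (adjacent-++∅ x hₓ (trans (cong (∅ {suc w} ++_) e) (∅++∅ (suc w))))
... | inj₂ (inj₁ (refl , h′)) = inj₁ (adjacent-∅++ (suc w) _ (adjacent-∅++ (suc w) _ h′))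
cyclicAdjacent-insert {w} (avoidsRight {inside ∷ x} {z}) (inj₂ h)
  with isLast-++⁻ x (∅ {suc w} ++ z) h
... | refl , h′ = inj₂ (isLast-∅++ w _ (isLast-∅++ (suc w) (∅ {suc w} ++ z) h′))

adjacent-windows : (a b : Subset (suc w)) → CyclicAdjacent (join (a , b , ∅ {suc m})) →
                     Adjacent (a ++ (b ++ ∅ {k}))
adjacent-windows {w} a b (inj₁ h) with adjacent-++⁻ a h
... | inj₁ (hₐ , e) with ++≡∅⁻ b e
...   | refl , _ = adjacent-++∅ a hₐ (∅++∅ (suc w))
adjacent-windows {w} {m} a b (inj₁ h) | inj₂ (inj₁ (refl , h′)) with adjacent-++⁻ b h′
... | inj₁ (h_b , _)         = adjacent-∅++ (suc w) (b ++ ∅) (adjacent-++∅ b h_b refl)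
... | inj₂ (inj₁ (_ , h∅))   = ⊥-elim (¬adjacent-∅ (suc m) h∅)
adjacent-windows a b (inj₁ h) | inj₂ (inj₂ (hₐ , h_b)) with isFirst-++⁻ b h_b
... | h_b′ , _ = adjacent-++⁺ a hₐ (isFirst-++∅ b h_b′ refl)
adjacent-windows {m = m} a b (inj₂ h) with wrapping-++⁻ a (b ++ ∅) h
... | _ , h_b with isLast-++⁻ b ∅ h_b
...   | _ , h∅ = ⊥-elim (¬isLast-∅ (suc m) h∅)

-- Where a cyclically adjacent pair can lie once a block p is inserted between
-- the windows x and y: away from the block, inside it, or across one of its ends.
cyclicAdjacent-inserted : (x p y : Subset (suc w)) (z : Subset (suc m)) →
  CyclicAdjacent (x ++ (p ++ (y ++ z))) →
    (p ≡ ∅ × AvoidsWindow (x , y , z) × CyclicAdjacent (join (x , y , z)))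
  ⊎ (x ≡ ∅ × y ++ z ≡ ∅ × Adjacent p)
  ⊎ (y ++ z ≡ ∅ × IsLast x × IsFirst p)
  ⊎ (x ≡ ∅ × z ≡ ∅ × IsLast p × IsFirst y)
cyclicAdjacent-inserted {w} x p y z (inj₁ h) with adjacent-++⁻ x h
... | inj₁ (hₓ , e) with ++≡∅⁻ p e
...   | refl , e′ with ++≡∅⁻ y e′
...     | refl , refl = inj₁ (refl , avoidsRight , inj₁ (adjacent-++∅ x hₓ (∅++∅ (suc w))))
cyclicAdjacent-inserted {w} x p y z (inj₁ h) | inj₂ (inj₁ (refl , h′))
  with adjacent-++⁻ p h′
... | inj₁ (hₚ , e)          = inj₂ (inj₁ (refl , e , hₚ))
... | inj₂ (inj₁ (refl , h″)) =
  inj₁ (refl , avoidsLeft , inj₁ (adjacent-∅++ (suc w) (y ++ z) h″))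
... | inj₂ (inj₂ (hₚ , h″)) with isFirst-++⁻ y h″
...   | h_y , refl = inj₂ (inj₂ (inj₂ (refl , refl , hₚ , h_y)))
cyclicAdjacent-inserted x p y z (inj₁ h) | inj₂ (inj₂ (hₓ , h′)) with isFirst-++⁻ p h′
... | hₚ , e = inj₂ (inj₂ (inj₁ (e , hₓ , hₚ)))
cyclicAdjacent-inserted {w} (inside ∷ x) p y z (inj₂ h)
  with isLast-++⁻ x (p ++ (y ++ z)) h
... | refl , h₁ with isLast-++⁻ p (y ++ z) h₁
...   | refl , h₂ with isLast-++⁻ y z h₂
...     | refl , h₃ =
  inj₁ (refl , avoidsRight , inj₂ (isLast-∅++ w _ (isLast-∅++ (suc w) z h₃)))

∅ₛ : Split w m
∅ₛ = ∅ , ∅ , ∅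

smallOrAdjacent-∅ₛ : SmallOrAdjacent (join (∅ₛ {w} {m}))
smallOrAdjacent-∅ₛ {w} {m} two
  with ≤-trans two (≤-reflexive (trans (∣∅++∣ (suc w) _) (trans (∣∅++∣ (suc w) _) (∣⊥∣≡0 (suc m)))))
... | ()

∣join-insert∣ : (σ : Split w m) → ∣ join (insert σ) ∣ ≡ ∣ join σ ∣
∣join-insert∣ {w} (x , y , z) =
  trans (∣++∣ x _) (trans (cong (∣ x ∣ +_) (∣∅++∣ (suc w) (y ++ z))) (sym (∣++∣ x (y ++ z))))

smallOrAdjacent-insert : ∀ {w m} {σ : Split w m} → AvoidsWindow σ →
                         SmallOrAdjacent (join σ) → SmallOrAdjacent (join (insert σ))
smallOrAdjacent-insert {σ = σ} a h two =
  cyclicAdjacent-insert a (h (subst (2 ≤_) (∣join-insert∣ σ) two))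

∣join-crossing∣ : (a b : Subset (suc w)) → ∣ join (a , b , ∅ {suc m}) ∣ ≡ ∣ a ∣ + ∣ b ∣
∣join-crossing∣ a b = trans (∣++∣ a _) (cong (∣ a ∣ +_) (∣++∅∣ b))

smallOrAdjacent-crossings : (a b : Subset (suc w)) →
  SmallOrAdjacent (join (a , b , ∅ {suc m})) → SmallOrAdjacent (join (a , b , ∅ {suc k}))
smallOrAdjacent-crossings {m = m} a b h two =
  inj₁ (adjacent-windows a b (h (subst (2 ≤_) ∣crossings∣ two)))
  where
  ∣crossings∣ = trans (∣join-crossing∣ a b) (sym (∣join-crossing∣ {m = m} a b))

smallOrAdjacent-shifted : (a b : Subset (suc w)) →
  SmallOrAdjacent (join (a , b , ∅ {suc m})) → SmallOrAdjacent (join {m = w + suc k} (∅ , a , b ++ ∅))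
smallOrAdjacent-shifted {w} {m} {k} a b h two =
  inj₁ (adjacent-∅++ (suc w) _ (adjacent-windows a b (h (subst (2 ≤_) ∣shifted∣ two))))
  where
  ∣shifted∣ : ∣ join {m = w + suc k} (∅ , a , b ++ ∅) ∣ ≡ ∣ join (a , b , ∅ {suc m}) ∣
  ∣shifted∣ = trans (∣∅++∣ (suc w) _) (trans (∣join-crossing∣ a b) (sym (∣join-crossing∣ a b)))

smallOrAdjacent-block : (s : Subset (suc w)) → (2 ≤ ∣ s ∣ → Adjacent s) →
                        SmallOrAdjacent (join (∅ , s , ∅ {suc m}))
smallOrAdjacent-block {w} s h two =
  inj₁ (adjacent-∅++ (suc w) _ (adjacent-++∅ s (h (subst (2 ≤_) ∣block∣ two)) refl))
  where
  ∣block∣ : ∣ join (∅ , s , ∅ {suc _}) ∣ ≡ ∣ s ∣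
  ∣block∣ = trans (∣∅++∣ (suc w) _) (∣++∅∣ s)

avoids-⊓ : ∀ {w m} {σ : Split w m} τ → AvoidsWindow σ → AvoidsWindow (σ ⊓ τ)
avoids-⊓ (x , _ , _) avoidsLeft  =
  subst (λ a → AvoidsWindow (a , _ , _)) (sym (∩-zeroˡ x)) avoidsLeft
avoids-⊓ (_ , y , _) avoidsRight =
  subst (λ b → AvoidsWindow (_ , b , _)) (sym (∩-zeroˡ y)) avoidsRight

smallOrAdjacent-≡ : ∀ {w m} {ρ ρ′ : Split w m} → ρ ≡ ρ′ →
                    SmallOrAdjacent (join ρ′) → SmallOrAdjacent (join ρ)
smallOrAdjacent-≡ eq = subst (λ ρ → SmallOrAdjacent (join ρ)) (sym eq)

smallOrAdjacent-comm : ∀ {w m} (σ τ : Split w m) →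
                       SmallOrAdjacent (join (σ ⊓ τ)) → SmallOrAdjacent (join (τ ⊓ σ))
smallOrAdjacent-comm σ τ = smallOrAdjacent-≡ (⊓-comm τ σ)

_≟ˢ_ : DecidableEquality (Subset n)
_≟ˢ_ = Vec.≡-dec _≟ᵇ_

isFirst? : (s : Subset n) → Dec (IsFirst s)
isFirst? []            = no λ ()
isFirst? (inside ∷ s)  = s ≟ˢ ∅
isFirst? (outside ∷ s) = no λ ()

isLast? : (s : Subset n) → Dec (IsLast s)
isLast? []              = no λ ()
isLast? (inside ∷ [])    = yes tt
isLast? (inside ∷ _ ∷ _) = no λ ()
isLast? (outside ∷ s)   = isLast? s

adjacent? : (s : Subset n) → Dec (Adjacent s)
adjacent? []            = no λ ()
adjacent? (inside ∷ s)  = isFirst? s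
adjacent? (outside ∷ s) = adjacent? s

cyclicAdjacent? : (s : Subset n) → Dec (CyclicAdjacent s)
cyclicAdjacent? []            = no λ { (inj₁ ()) ; (inj₂ ()) }
cyclicAdjacent? (inside ∷ s)  = isFirst? s ⊎-dec isLast? s
cyclicAdjacent? (outside ∷ s) = adjacent? s ⊎-dec no λ ()

smallOrAdjacent? : (s : Subset n) → Dec (SmallOrAdjacent s)
smallOrAdjacent? s = (2 ≤? ∣ s ∣) →-dec cyclicAdjacent? s

adjacentPairs : ∀ n → List (Subset n)
adjacentPairs (suc (suc n)) = (inside ∷ inside ∷ ∅) ∷ map (outside ∷_) (adjacentPairs (suc n))
adjacentPairs _             = []

adjacent∈adjacentPairs : (s : Subset n) → Adjacent s → s ∈ adjacentPairs n
adjacent∈adjacentPairs (inside ∷ inside ∷ _) refl = here refl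
adjacent∈adjacentPairs (outside ∷ s@(_ ∷ _)) h =
  there (∈-map⁺ (outside ∷_) (adjacent∈adjacentPairs s h))

cyclicPairs : ∀ n → List (Subset n)
cyclicPairs (suc (suc n)) = (inside ∷ ⁅ fromℕ n ⁆) ∷ adjacentPairs (suc (suc n))
cyclicPairs _             = []

cyclicAdjacent∈cyclicPairs : (s : Subset n) → CyclicAdjacent s → s ∈ cyclicPairs n
cyclicAdjacent∈cyclicPairs s@(_ ∷ _ ∷ _) (inj₁ h) = there (adjacent∈adjacentPairs s h)
cyclicAdjacent∈cyclicPairs (inside ∷ [])  (inj₁ ())
cyclicAdjacent∈cyclicPairs (outside ∷ []) (inj₁ ())
cyclicAdjacent∈cyclicPairs (inside ∷ s@(_ ∷ _)) (inj₂ h) =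
  here (cong (inside ∷_) (isLast⇒⁅fromℕ⁆ s h))

_≟ₛ_ : DecidableEquality (Split w m)
_≟ₛ_ = Product.≡-dec _≟ˢ_ (Product.≡-dec _≟ˢ_ _≟ˢ_)

avoidsWindow? : (σ : Split w m) → Dec (AvoidsWindow σ)
avoidsWindow? (x , y , z) with x ≟ˢ ∅ | y ≟ˢ ∅
... | yes refl | _        = yes avoidsLeft
... | no _     | yes refl = yes avoidsRight
... | no x≢∅   | no y≢∅   = no λ { avoidsLeft → x≢∅ refl ; avoidsRight → y≢∅ refl }

SoundCheck : List (Split w m) → Set
SoundCheck L = All (λ σ → All (λ τ → σ ≢ τ → SmallOrAdjacent (join (σ ⊓ τ))) L) L

soundCheck? : (L : List (Split w m)) → Dec (SoundCheck L)
soundCheck? L = all? (λ σ → all? (λ τ → ¬? (σ ≟ₛ τ) →-dec smallOrAdjacent? (join (σ ⊓ τ))) L) L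

soundCheck⇒soundOn : {L : List (Split w m)} → SoundCheck L → SoundOn L
soundCheck⇒soundOn c σ∈ τ∈ = All.lookup (All.lookup c σ∈) τ∈

CompleteCheck : List (Split w m) → Set
CompleteCheck {w} {m} L = All (λ s → Any (λ σ → Any (λ τ → σ ≢ τ × s ≡ join (σ ⊓ τ)) L) L)
                              (cyclicPairs (suc w + (suc w + suc m)))

completeCheck? : (L : List (Split w m)) → Dec (CompleteCheck L)
completeCheck? L =
  all? (λ s → any? (λ σ → any? (λ τ → ¬? (σ ≟ₛ τ) ×-dec (s ≟ˢ join (σ ⊓ τ))) L) L) _

find² : ∀ {A B : Set} {P : A → B → Set} {xs ys} →
        Any (λ x → Any (P x) ys) xs → ∃₂ λ x y → x ∈ xs × y ∈ ys × P x y
find² any-x with find any-x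
... | x , x∈ , any-y with find any-y
...   | y , y∈ , p = x , y , x∈ , y∈ , p

completeCheck⇒completeOn : {L : List (Split w m)} → CompleteCheck L → CompleteOn L
completeCheck⇒completeOn c {s} h = find² (All.lookup c (cyclicAdjacent∈cyclicPairs s h))

-- The window parts (l , r) of the edges crossing a seam.
Profile : ℕ → Set
Profile w = List (Subset (suc w) × Subset (suc w))

-- The conditions on the meets r ∩ l′ of the right part of one crossing edge with
-- the left part of another, as they appear inside the inserted copy of the windows.
record Admissible (P : Profile w) : Set where
  field
    sides-nonempty : All (λ p → proj₁ p ≢ ∅ × proj₂ p ≢ ∅) P
    profile-unique : Unique P
    meets-adjacent : ∀ {p q} → p ∈ P → q ∈ P →
                     2 ≤ ∣ proj₂ p ∩ proj₁ q ∣ → Adjacent (proj₂ p ∩ proj₁ q)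
    adjacent-meets : ∀ {s} → Adjacent s →
                     ∃₂ λ p q → p ∈ P × q ∈ P × s ≡ proj₂ p ∩ proj₁ q

module Seam {w} (P : Profile w) (admissible : Admissible P) where

  open Admissible admissible

  crossing : Subset (suc w) × Subset (suc w) → Split w m
  crossing (l , r) = l , r , ∅

  shifted : Subset (suc w) × Subset (suc w) → Split w (w + suc m)
  shifted (l , r) = ∅ , l , r ++ ∅

  edgesOf : List (Split w m) → List (Split w m)
  edgesOf I = I ++ˡ map crossing P

  -- The copy becomes the new right window and the old right window starts the rest:
  -- crossing (l , r) now stands for l ∪ r′ and shifted (l , r) for l′ ∪ r.
  grow : List (Split w m) → List (Split w (w + suc m))
  grow I = map insert I ++ˡ map shifted P

  data Edge (I : List (Split w m)) : Split w m → Set where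
    interior : σ ∈ I → Edge I σ
    crossingᴾ : ∀ {p} → p ∈ P → Edge I (crossing p)

  edge : {I : List (Split w m)} → σ ∈ edgesOf I → Edge I σ
  edge {I = I} σ∈ with ∈-++⁻ I σ∈
  ... | inj₁ σ∈I = interior σ∈I
  ... | inj₂ σ∈P with ∈-map⁻ crossing σ∈P
  ...   | p , p∈ , refl = crossingᴾ p∈

  data GrownEdge (I : List (Split w m)) : Split w (w + suc m) → Set where
    inserted  : σ ∈ I → GrownEdge I (insert σ)
    shiftedᴾ  : ∀ {p} → p ∈ P → GrownEdge I (shifted p)
    crossingᴾ : ∀ {p} → p ∈ P → GrownEdge I (crossing p)

  grownEdge : {I : List (Split w m)} {σ′ : Split w (w + suc m)} →
              σ′ ∈ edgesOf (grow I) → GrownEdge I σ′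
  grownEdge {I = I} σ′∈ with ∈-++⁻ (grow I) σ′∈
  ... | inj₂ σ′∈P with ∈-map⁻ crossing σ′∈P
  ...   | p , p∈ , refl = crossingᴾ p∈
  grownEdge {I = I} σ′∈ | inj₁ σ′∈G with ∈-++⁻ (map insert I) σ′∈G
  ... | inj₁ σ′∈I with ∈-map⁻ insert σ′∈I
  ...   | σ , σ∈ , refl = inserted σ∈
  grownEdge σ′∈ | inj₁ _ | inj₂ σ′∈S with ∈-map⁻ shifted σ′∈S
  ... | p , p∈ , refl = shiftedᴾ p∈

  insert-⊓-insert : (σ τ : Split w m) → insert σ ⊓ insert τ ≡ insert (σ ⊓ τ)
  insert-⊓-insert (x , y , z) (x′ , y′ , z′) = split-cong refl (∩-zeroˡ ∅) (∩-++ y y′ z z′)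

  insertᴸ-⊓-crossing : ∀ (y : Subset (suc w)) (z : Subset (suc m)) l r →
                       insert (∅ , y , z) ⊓ crossing (l , r) ≡ ∅ₛ
  insertᴸ-⊓-crossing y z l r = split-cong (∩-zeroˡ l) (∩-zeroˡ r) (∩-zeroʳ (y ++ z))

  insertᴸ-⊓-shifted : ∀ (y : Subset (suc w)) (z : Subset (suc m)) l r →
                      insert (∅ , y , z) ⊓ shifted (l , r) ≡ insert ((∅ , y , z) ⊓ crossing (l , r))
  insertᴸ-⊓-shifted y z l r =
    split-cong (trans (∩-zeroˡ ∅) (sym (∩-zeroˡ l))) (∩-zeroˡ l) (∩-++ y r z ∅)

  insertᴿ-⊓-crossing : ∀ (x : Subset (suc w)) (z : Subset (suc m)) l r →
                       insert (x , ∅ , z) ⊓ crossing (l , r) ≡ insert ((x , ∅ , z) ⊓ crossing (l , r))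
  insertᴿ-⊓-crossing x z l r = split-cong refl (∩-zeroˡ r)
    (trans (∩-zeroʳ (∅ ++ z))
           (sym (trans (cong₂ _++_ (∩-zeroˡ r) (∩-zeroʳ z)) (∅++∅ (suc w)))))

  insertᴿ-⊓-shifted : ∀ (x : Subset (suc w)) (z : Subset (suc m)) l r →
                      insert (x , ∅ , z) ⊓ shifted (l , r) ≡ ∅ₛ
  insertᴿ-⊓-shifted x z l r = split-cong (∩-zeroʳ x) (∩-zeroˡ l)
    (trans (∩-++ ∅ r z ∅) (trans (cong₂ _++_ (∩-zeroˡ r) (∩-zeroʳ z)) (∅++∅ (suc w))))

  crossing-⊓-crossing : ∀ l r l′ r′ →
                        crossing {m = m} (l , r) ⊓ crossing (l′ , r′) ≡ (l ∩ l′ , r ∩ r′ , ∅)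
  crossing-⊓-crossing l r l′ r′ = split-cong refl refl (∩-zeroˡ ∅)

  shifted-⊓-shifted : ∀ l r l′ r′ →
                      shifted {m = m} (l , r) ⊓ shifted (l′ , r′) ≡ (∅ , l ∩ l′ , (r ∩ r′) ++ ∅)
  shifted-⊓-shifted l r l′ r′ =
    split-cong (∩-zeroˡ ∅) refl (trans (∩-++ r r′ ∅ ∅) (cong ((r ∩ r′) ++_) (∩-zeroˡ ∅)))

  crossing-⊓-shifted : ∀ l r l′ r′ →
                       crossing {m = w + suc m} (l , r) ⊓ shifted (l′ , r′) ≡ (∅ , r ∩ l′ , ∅)
  crossing-⊓-shifted l r l′ r′ = split-cong (∩-zeroʳ l) refl (∩-zeroˡ _)

  crossing-injective : ∀ {p q} → crossing {m = m} p ≡ crossing q → p ≡ q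
  crossing-injective refl = refl

  interior∈ : {I : List (Split w m)} → σ ∈ I → σ ∈ edgesOf I
  interior∈ = ∈-++⁺ˡ

  crossing∈ : {I : List (Split w m)} {p : Subset (suc w) × Subset (suc w)} →
              p ∈ P → crossing p ∈ edgesOf I
  crossing∈ {I = I} p∈ = ∈-++⁺ʳ I (∈-map⁺ crossing p∈)

  interior≢crossing : ∀ {p} → AvoidsWindow σ → p ∈ P → σ ≢ crossing p
  interior≢crossing avoidsLeft  p∈ eq =
    proj₁ (All.lookup sides-nonempty p∈) (sym (cong proj₁ eq))
  interior≢crossing avoidsRight p∈ eq =
    proj₂ (All.lookup sides-nonempty p∈) (sym (cong (proj₁ ∘ proj₂) eq))

  module _ {m} {I : List (Split w m)} (avoids : All AvoidsWindow I)
           (sound : SoundOn (edgesOf I)) where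

    inserted-inserted : σ ∈ I → τ ∈ I → insert σ ≢ insert τ →
                        SmallOrAdjacent (join (insert σ ⊓ insert τ))
    inserted-inserted {σ = σ} {τ} σ∈ τ∈ ne = smallOrAdjacent-≡ (insert-⊓-insert σ τ) $
      smallOrAdjacent-insert (avoids-⊓ τ (All.lookup avoids σ∈))
        (sound (interior∈ σ∈) (interior∈ τ∈) (ne ∘ cong insert))

    inserted-crossing : ∀ {p} → σ ∈ I → p ∈ P → SmallOrAdjacent (join (insert σ ⊓ crossing p))
    inserted-crossing {p = l , r} σ∈ p∈ with All.lookup avoids σ∈
    ... | avoidsLeft {y} {z} =
      smallOrAdjacent-≡ (insertᴸ-⊓-crossing y z l r) (smallOrAdjacent-∅ₛ {w} {w + suc m})
    ... | avoidsRight {x} {z} = smallOrAdjacent-≡ (insertᴿ-⊓-crossing x z l r) $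
      smallOrAdjacent-insert (avoids-⊓ (l , r , ∅) (avoidsRight {x = x} {z}))
        (sound (interior∈ σ∈) (crossing∈ p∈) (interior≢crossing avoidsRight p∈))

    inserted-shifted : ∀ {p} → σ ∈ I → p ∈ P → SmallOrAdjacent (join (insert σ ⊓ shifted p))
    inserted-shifted {p = l , r} σ∈ p∈ with All.lookup avoids σ∈
    ... | avoidsRight {x} {z} =
      smallOrAdjacent-≡ (insertᴿ-⊓-shifted x z l r) (smallOrAdjacent-∅ₛ {w} {w + suc m})
    ... | avoidsLeft {y} {z} = smallOrAdjacent-≡ (insertᴸ-⊓-shifted y z l r) $
      smallOrAdjacent-insert (avoids-⊓ (l , r , ∅) (avoidsLeft {y = y} {z}))
        (sound (interior∈ σ∈) (crossing∈ p∈) (interior≢crossing avoidsLeft p∈))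

    sound-crossings : ∀ {l r l′ r′} → (l , r) ∈ P → (l′ , r′) ∈ P → (l , r) ≢ (l′ , r′) →
                    SmallOrAdjacent (join (l ∩ l′ , r ∩ r′ , ∅ {suc m}))
    sound-crossings {l} {r} {l′} {r′} p∈ q∈ ne =
      smallOrAdjacent-≡ (sym (crossing-⊓-crossing l r l′ r′))
        (sound (crossing∈ p∈) (crossing∈ q∈) (ne ∘ crossing-injective))

    crossing-crossing : ∀ {p q} → p ∈ P → q ∈ P → crossing {m = w + suc m} p ≢ crossing q →
                        SmallOrAdjacent (join (crossing {m = w + suc m} p ⊓ crossing q))
    crossing-crossing {l , r} {l′ , r′} p∈ q∈ ne =
      smallOrAdjacent-≡ (crossing-⊓-crossing {m = w + suc m} l r l′ r′) $
        smallOrAdjacent-crossings (l ∩ l′) (r ∩ r′) (sound-crossings p∈ q∈ (ne ∘ cong crossing))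

    shifted-shifted : ∀ {p q} → p ∈ P → q ∈ P → shifted {m = m} p ≢ shifted q →
                      SmallOrAdjacent (join (shifted {m = m} p ⊓ shifted q))
    shifted-shifted {l , r} {l′ , r′} p∈ q∈ ne =
      smallOrAdjacent-≡ (shifted-⊓-shifted {m = m} l r l′ r′) $
        smallOrAdjacent-shifted (l ∩ l′) (r ∩ r′) (sound-crossings p∈ q∈ (ne ∘ cong shifted))

    crossing-shifted : ∀ {p q} → p ∈ P → q ∈ P →
                       SmallOrAdjacent (join (crossing {m = w + suc m} p ⊓ shifted q))
    crossing-shifted {l , r} {l′ , r′} p∈ q∈ =
      smallOrAdjacent-≡ (crossing-⊓-shifted {m = m} l r l′ r′) $
        smallOrAdjacent-block (r ∩ l′) (meets-adjacent p∈ q∈)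

    sound-grown : {σ′ τ′ : Split w (w + suc m)} → GrownEdge I σ′ → GrownEdge I τ′ → σ′ ≢ τ′ →
                  SmallOrAdjacent (join (σ′ ⊓ τ′))
    sound-grown (inserted σ∈)  (inserted τ∈)  ne = inserted-inserted σ∈ τ∈ ne
    sound-grown (inserted σ∈)  (shiftedᴾ p∈)  _  = inserted-shifted σ∈ p∈
    sound-grown (inserted σ∈)  (crossingᴾ p∈) _  = inserted-crossing σ∈ p∈
    sound-grown (shiftedᴾ {p} p∈) (inserted {σ} σ∈) _ =
      smallOrAdjacent-comm (insert σ) (shifted p) (inserted-shifted σ∈ p∈)
    sound-grown (shiftedᴾ p∈)  (shiftedᴾ q∈)  ne = shifted-shifted p∈ q∈ ne
    sound-grown (shiftedᴾ {p} p∈) (crossingᴾ {q} q∈) _ =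
      smallOrAdjacent-comm (crossing q) (shifted p) (crossing-shifted q∈ p∈)
    sound-grown (crossingᴾ {p} p∈) (inserted {σ} σ∈) _ =
      smallOrAdjacent-comm (insert σ) (crossing p) (inserted-crossing σ∈ p∈)
    sound-grown (crossingᴾ p∈) (shiftedᴾ q∈)  _  = crossing-shifted p∈ q∈
    sound-grown (crossingᴾ p∈) (crossingᴾ q∈) ne = crossing-crossing p∈ q∈ ne

    grow-sound : SoundOn (edgesOf (grow I))
    grow-sound σ′∈ τ′∈ = sound-grown (grownEdge σ′∈) (grownEdge τ′∈)

  inserted∈ : {I : List (Split w m)} → σ ∈ I → insert σ ∈ edgesOf (grow I)
  inserted∈ σ∈ = ∈-++⁺ˡ (∈-++⁺ˡ (∈-map⁺ insert σ∈))

  shifted∈ : {I : List (Split w m)} {p : Subset (suc w) × Subset (suc w)} →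
             p ∈ P → shifted p ∈ edgesOf (grow I)
  shifted∈ {I = I} p∈ = ∈-++⁺ˡ (∈-++⁺ʳ (map insert I) (∈-map⁺ shifted p∈))

  insert-injective : {σ τ : Split w m} → insert σ ≡ insert τ → σ ≡ τ
  insert-injective {σ = x , y , z} {x′ , y′ , z′} eq
    with ++-injective y y′ (cong (proj₂ ∘ proj₂) eq)
  ... | refl , refl = split-cong (cong proj₁ eq) refl refl

  shifted-injective : ∀ {p q} → shifted {m = m} p ≡ shifted q → p ≡ q
  shifted-injective {p = l , r} {l′ , r′} eq with ++-injective r r′ (cong (proj₂ ∘ proj₂) eq)
  ... | refl , _ = cong (_, r) (cong (proj₁ ∘ proj₂) eq)

  insert≢crossing : ∀ {p} → p ∈ P → insert {m = m} σ ≢ crossing p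
  insert≢crossing p∈ eq = proj₂ (All.lookup sides-nonempty p∈) (sym (cong (proj₁ ∘ proj₂) eq))

  insert≢shifted : ∀ {p} → p ∈ P → insert {m = m} σ ≢ shifted p
  insert≢shifted p∈ eq = proj₁ (All.lookup sides-nonempty p∈) (sym (cong (proj₁ ∘ proj₂) eq))

  crossing≢shifted : ∀ {p q} → p ∈ P → crossing {m = w + suc m} p ≢ shifted q
  crossing≢shifted p∈ eq = proj₁ (All.lookup sides-nonempty p∈) (cong proj₁ eq)

  interior-misses-straddle : {I : List (Split w m)} → All AvoidsWindow I → σ ∈ I →
    ∀ {a b c} → IsLast a → IsFirst b → (a , b , c) ≡ σ ⊓ τ → ⊥
  interior-misses-straddle {τ = x′ , _ , _} avoids σ∈ hₐ _ eq with All.lookup avoids σ∈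
  ... | avoidsLeft = ¬isLast-∅ (suc w) (subst IsLast (trans (cong proj₁ eq) (∩-zeroˡ x′)) hₐ)
  interior-misses-straddle {τ = _ , y′ , _} avoids σ∈ _ h_b eq | avoidsRight =
    subst IsFirst (trans (cong (proj₁ ∘ proj₂) eq) (∩-zeroˡ y′)) h_b

  module _ {m} {I : List (Split w m)} (avoids : All AvoidsWindow I)
           (complete : CompleteOn (edgesOf I)) where

    realise-interior-crossing : ∀ {σ p t} → σ ∈ I → p ∈ P → t ≡ σ ⊓ crossing p →
                        Realised (edgesOf (grow I)) (join (insert t))
    realise-interior-crossing {p = l , r} σ∈ p∈ eq with All.lookup avoids σ∈
    ... | avoidsLeft {y} {z} =
      _ , _ , inserted∈ σ∈ , shifted∈ p∈ , insert≢shifted {σ = ∅ , y , z} p∈ ,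
      cong join (trans (cong insert eq) (sym (insertᴸ-⊓-shifted y z l r)))
    ... | avoidsRight {x} {z} =
      _ , _ , inserted∈ σ∈ , crossing∈ p∈ , insert≢crossing {σ = x , ∅ , z} p∈ ,
      cong join (trans (cong insert eq) (sym (insertᴿ-⊓-crossing x z l r)))

    realise-crossings : ∀ {p q t} → AvoidsWindow t → p ∈ P → q ∈ P → p ≢ q →
                t ≡ crossing p ⊓ crossing q → Realised (edgesOf (grow I)) (join (insert t))
    realise-crossings {l , r} {l′ , r′} avoidsRight p∈ q∈ ne eq =
      _ , _ , crossing∈ p∈ , crossing∈ q∈ , ne ∘ crossing-injective ,
      cong join (trans (split-cong (cong proj₁ eq′) (cong (proj₁ ∘ proj₂) eq′)
                                   (trans (cong (∅ {suc w} ++_) (cong (proj₂ ∘ proj₂) eq′))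
                                          (∅++∅ (suc w))))
                       (sym (crossing-⊓-crossing {m = w + suc m} l r l′ r′)))
      where eq′ = trans eq (crossing-⊓-crossing {m = m} l r l′ r′)
    realise-crossings {l , r} {l′ , r′} avoidsLeft p∈ q∈ ne eq =
      _ , _ , shifted∈ p∈ , shifted∈ q∈ , ne ∘ shifted-injective ,
      cong join (trans (split-cong refl (cong proj₁ eq′)
                                   (cong₂ _++_ (cong (proj₁ ∘ proj₂) eq′) (cong (proj₂ ∘ proj₂) eq′)))
                       (sym (shifted-⊓-shifted {m = m} l r l′ r′)))
      where eq′ = trans eq (crossing-⊓-crossing {m = m} l r l′ r′)

    realise-inserted : ∀ {σ τ t} → AvoidsWindow t → Edge I σ → Edge I τ → σ ≢ τ → t ≡ σ ⊓ τ →
                       Realised (edgesOf (grow I)) (join (insert t))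
    realise-inserted {σ} {τ} _ (interior σ∈) (interior τ∈) ne eq =
      _ , _ , inserted∈ σ∈ , inserted∈ τ∈ , ne ∘ insert-injective ,
      cong join (trans (cong insert eq) (sym (insert-⊓-insert σ τ)))
    realise-inserted _ (interior σ∈)  (crossingᴾ p∈) _ eq = realise-interior-crossing σ∈ p∈ eq
    realise-inserted {σ} {τ} _ (crossingᴾ p∈) (interior τ∈)  _ eq =
      realise-interior-crossing τ∈ p∈ (trans eq (⊓-comm σ τ))
    realise-inserted a (crossingᴾ p∈) (crossingᴾ q∈) ne eq =
      realise-crossings a p∈ q∈ (ne ∘ cong crossing) eq

    straddle-crossings : ∀ {σ τ a b c} → IsLast a → IsFirst b → Edge I σ → Edge I τ →
                         (a , b , c) ≡ σ ⊓ τ →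
                         ∃₂ λ p q → p ∈ P × q ∈ P × σ ≡ crossing p × τ ≡ crossing q
    straddle-crossings hₐ h_b (interior σ∈) _ eq =
      ⊥-elim (interior-misses-straddle avoids σ∈ hₐ h_b eq)
    straddle-crossings {σ} {τ} hₐ h_b (crossingᴾ _) (interior τ∈) eq =
      ⊥-elim (interior-misses-straddle avoids τ∈ hₐ h_b (trans eq (⊓-comm σ τ)))
    straddle-crossings _ _ (crossingᴾ p∈) (crossingᴾ q∈) _ = _ , _ , p∈ , q∈ , refl , refl

    realise-block : ∀ p {u} → u ≡ ∅ → Adjacent p → Realised (edgesOf (grow I)) (join (∅ , p , u))
    realise-block p refl h with adjacent-meets {s = p} h
    ... | (l , r) , (l′ , r′) , p∈ , q∈ , eq =
      _ , _ , crossing∈ p∈ , shifted∈ q∈ , crossing≢shifted p∈ ,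
      cong join (trans (split-cong refl eq refl) (sym (crossing-⊓-shifted {m = m} l r l′ r′)))

    realise-left-seam : ∀ x p {u} → u ≡ ∅ → IsLast x → IsFirst p →
                        Realised (edgesOf (grow I)) (join (x , p , u))
    realise-left-seam x p refl hₓ hₚ
      with complete {s = join (x , p , ∅)} (inj₁ (adjacent-++⁺ x hₓ (isFirst-++∅ p hₚ refl)))
    ... | _ , _ , σ∈ , τ∈ , ne , eq
      with straddle-crossings hₓ hₚ (edge σ∈) (edge τ∈) (join-injective {σ = x , p , ∅} eq)
    ... | (l , r) , (l′ , r′) , p∈ , q∈ , refl , refl =
      _ , _ , crossing∈ p∈ , crossing∈ q∈ , ne ∘ cong crossing ∘ crossing-injective ,
      cong join (trans (split-cong (cong proj₁ eq′) (cong (proj₁ ∘ proj₂) eq′) refl)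
                       (sym (crossing-⊓-crossing {m = w + suc m} l r l′ r′)))
      where eq′ = trans (join-injective {σ = x , p , ∅} eq) (crossing-⊓-crossing {m = m} l r l′ r′)

    realise-right-seam : ∀ p y → IsLast p → IsFirst y →
                         Realised (edgesOf (grow I)) (join (∅ , p , y ++ ∅))
    realise-right-seam p y hₚ h_y
      with complete {s = join (p , y , ∅)} (inj₁ (adjacent-++⁺ p hₚ (isFirst-++∅ y h_y refl)))
    ... | _ , _ , σ∈ , τ∈ , ne , eq
      with straddle-crossings hₚ h_y (edge σ∈) (edge τ∈) (join-injective {σ = p , y , ∅} eq)
    ... | (l , r) , (l′ , r′) , p∈ , q∈ , refl , refl =
      _ , _ , shifted∈ p∈ , shifted∈ q∈ , ne ∘ cong crossing ∘ shifted-injective ,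
      cong join (trans (split-cong refl (cong proj₁ eq′) (cong (_++ ∅) (cong (proj₁ ∘ proj₂) eq′)))
                       (sym (shifted-⊓-shifted {m = m} l r l′ r′)))
      where eq′ = trans (join-injective {σ = p , y , ∅} eq) (crossing-⊓-crossing {m = m} l r l′ r′)

    grow-complete : CompleteOn (edgesOf (grow I))
    grow-complete {s′} h with split s′
    ... | (x , p , u) , refl with splitAt (suc w) u
    ... | y , z , refl with cyclicAdjacent-inserted x p y z h
    ... | inj₁ (refl , a , h′) with complete {s = join (x , y , z)} h′
    ...   | _ , _ , σ∈ , τ∈ , ne , eq =
      realise-inserted a (edge σ∈) (edge τ∈) ne (join-injective {σ = x , y , z} eq)
    grow-complete _ | (x , p , _) , refl | y , _ , refl | inj₂ (inj₁ (refl , e , hₚ)) =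
      realise-block p e hₚ
    grow-complete _ | (x , p , _) , refl | y , _ , refl | inj₂ (inj₂ (inj₁ (e , hₓ , hₚ))) =
      realise-left-seam x p e hₓ hₚ
    grow-complete _ | (x , p , _) , refl | y , _ , refl | inj₂ (inj₂ (inj₂ (refl , refl , hₚ , h_y))) =
      realise-right-seam p y hₚ h_y

  grow-avoids : (I : List (Split w m)) → All AvoidsWindow (grow I)
  grow-avoids I = All.++⁺ (All.map⁺ (All.universal (λ _ → avoidsRight) I))
                          (All.map⁺ (All.universal (λ _ → avoidsLeft) P))

  grow-unique : {I : List (Split w m)} → Unique I → Unique (grow I)
  grow-unique unique-I = Unique.++⁺ (Unique.map⁺ insert-injective unique-I)
                                    (Unique.map⁺ shifted-injective profile-unique) disjoint
    where
    disjoint : ∀ {σ′} → ¬ (σ′ ∈ map insert _ × σ′ ∈ map shifted P)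
    disjoint (σ′∈ , σ′∈′) with ∈-map⁻ insert σ′∈ | ∈-map⁻ shifted σ′∈′
    ... | σ , _ , refl | _ , p∈ , eq = insert≢shifted {σ = σ} p∈ eq

  edges-unique : {I : List (Split w m)} → All AvoidsWindow I → Unique I → Unique (edgesOf I)
  edges-unique avoids unique-I =
    Unique.++⁺ unique-I (Unique.map⁺ crossing-injective profile-unique) disjoint
    where
    disjoint : ∀ {σ} → ¬ (σ ∈ _ × σ ∈ map crossing P)
    disjoint (σ∈ , σ∈′) with ∈-map⁻ crossing σ∈′
    ... | _ , p∈ , refl = interior≢crossing (All.lookup avoids σ∈) p∈ refl

  ∣join-shifted∣ : ∀ p → ∣ join (shifted {m = m} p) ∣ ≡ ∣ proj₁ p ∣ + ∣ proj₂ p ∣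
  ∣join-shifted∣ (l , r) = trans (∣∅++∣ (suc w) _) (∣join-crossing∣ l r)

  record Seamed (k : ℕ) (I : List (Split w m)) : Set where
    field
      avoids          : All AvoidsWindow I
      interior-unique : Unique I
      uniform         : All (λ σ → ∣ join σ ∣ ≡ k) I
      sound           : SoundOn (edgesOf I)
      complete        : CompleteOn (edgesOf I)

  grow-seamed : ∀ {k} {I : List (Split w m)} → All (λ p → ∣ proj₁ p ∣ + ∣ proj₂ p ∣ ≡ k) P →
                Seamed k I → Seamed k (grow I)
  grow-seamed {I = I} uniform-P seamed = record
    { avoids          = grow-avoids I
    ; interior-unique = grow-unique interior-unique
    ; uniform         = All.++⁺ (All.map⁺ (All.map (λ {σ} eq → trans (∣join-insert∣ σ) eq) uniform))
                                (All.map⁺ (All.map (λ {p} eq → trans (∣join-shifted∣ p) eq) uniform-P))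
    ; sound           = grow-sound avoids sound
    ; complete        = grow-complete avoids complete
    }
    where open Seamed seamed

  SeamedCheck : ℕ → List (Split w m) → Set
  SeamedCheck k I = All AvoidsWindow I × Unique I × All (λ σ → ∣ join σ ∣ ≡ k) I ×
                    SoundCheck (edgesOf I) × CompleteCheck (edgesOf I)

  seamedCheck? : ∀ k (I : List (Split w m)) → Dec (SeamedCheck k I)
  seamedCheck? k I = all? avoidsWindow? I ×-dec allPairs? (λ σ τ → ¬? (σ ≟ₛ τ)) I ×-dec
                     all? (λ σ → ∣ join σ ∣ ≟ k) I ×-dec soundCheck? _ ×-dec completeCheck? _

  seamedCheck⇒seamed : ∀ {k} {I : List (Split w m)} → SeamedCheck k I → Seamed k I
  seamedCheck⇒seamed (avoids , unique-I , uniform , sound , complete) = record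
    { avoids          = avoids
    ; interior-unique = unique-I
    ; uniform         = uniform
    ; sound           = soundCheck⇒soundOn sound
    ; complete        = completeCheck⇒completeOn complete
    }

  length-grow : (I : List (Split w m)) → length (grow I) ≡ length I + length P
  length-grow I =
    trans (length-++ (map insert I)) (cong₂ _+_ (length-map insert I) (length-map shifted P))

  toHypergraph : ∀ {k} {I : List (Split w m)} → Seamed k I → Hypergraph (suc w + (suc w + suc m))
  toHypergraph {I = I} s = hypergraph (map join (edgesOf I))
    (Unique.map⁺ join-injective (edges-unique avoids interior-unique))
    where open Seamed s

  toHypergraph-uniform : ∀ {k} {I : List (Split w m)} →
                         All (λ p → ∣ proj₁ p ∣ + ∣ proj₂ p ∣ ≡ k) P →
                         (s : Seamed k I) → IsUniform k (toHypergraph s)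
  toHypergraph-uniform uniform-P s = All.map⁺ (All.++⁺ uniform (All.map⁺ (All.map
    (λ {p} eq → trans (∣join-crossing∣ (proj₁ p) (proj₂ p)) eq) uniform-P)))
    where open Seamed s

  toHypergraph-eiIsCycle : ∀ {k} {I : List (Split w m)} (s : Seamed k I) → EIisCycle (toHypergraph s)
  toHypergraph-eiIsCycle {I = I} s =
    eiIsCycle {L = edgesOf I} (unique (toHypergraph s)) sound complete
    where open Seamed s

  numEdges-toHypergraph : ∀ {k} {I : List (Split w m)} (s : Seamed k I) →
                          numEdges (toHypergraph s) ≡ length I + length P
  numEdges-toHypergraph {I = I} _ = trans (length-map join (edgesOf I))
    (trans (length-++ I) (cong (length I +_) (length-map crossing P)))

-- The construction

vertices : List ℕ → Subset n
vertices vs = tabulate λ i → any (toℕ i ≡ᵇ_) vs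

splitOf : List ℕ → Split w m
splitOf vs = proj₁ (split (vertices vs))

-- The seam of the hypergraph for n = 4q formed by the blocks {2i, …, 2i+3} and the
-- hyperedges {4i+1, 4i+2, 4i+7, 4i+8}, cut between 4i+4 and 4i+5.
P₄ : Profile 3
P₄ = (vertices (1 ∷ 2 ∷ 3 ∷ []) , vertices (0 ∷ []))
   ∷ (vertices (3 ∷ [])         , vertices (0 ∷ 1 ∷ 2 ∷ []))
   ∷ (vertices (0 ∷ 1 ∷ [])     , vertices (2 ∷ 3 ∷ []))
   ∷ []

P₄-uniform : All (λ p → ∣ proj₁ p ∣ + ∣ proj₂ p ∣ ≡ 4) P₄
P₄-uniform = from-yes (all? (λ p → ∣ proj₁ p ∣ + ∣ proj₂ p ∣ ≟ 4) P₄)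

P₄-admissible : Admissible P₄
P₄-admissible = record
  { sides-nonempty = from-yes (all? (λ p → ¬? (proj₁ p ≟ˢ ∅) ×-dec ¬? (proj₂ p ≟ˢ ∅)) P₄)
  ; profile-unique = from-yes (allPairs? (λ p q → ¬? (Product.≡-dec _≟ˢ_ _≟ˢ_ p q)) P₄)
  ; meets-adjacent = λ p∈ q∈ → All.lookup (All.lookup meets p∈) q∈
  ; adjacent-meets = λ {s} h → find² (All.lookup realised (adjacent∈adjacentPairs s h))
  }
  where
  meet : Subset 4 × Subset 4 → Subset 4 × Subset 4 → Subset 4
  meet p q = proj₂ p ∩ proj₁ q
  meets : All (λ p → All (λ q → 2 ≤ ∣ meet p q ∣ → Adjacent (meet p q)) P₄) P₄
  meets = from-yes (all? (λ p → all? (λ q → (2 ≤? ∣ meet p q ∣) →-dec adjacent? (meet p q)) P₄) P₄)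
  realised : All (λ s → Any (λ p → Any (λ q → s ≡ meet p q) P₄) P₄) (adjacentPairs 4)
  realised = from-yes (all? (λ s → any? (λ p → any? (λ q → s ≟ˢ meet p q) P₄) P₄) (adjacentPairs 4))

open Seam P₄ P₄-admissible

record Construction (m : ℕ) : Set where
  field
    interiorEdges : List (Split 3 m)
    seamed        : Seamed 4 interiorEdges
    count         : length interiorEdges + 3 ≡ ceil3n/4 (4 + (4 + suc m))

fromCheck : (I : List (Split 3 m)) {{_ : True (seamedCheck? 4 I)}} →
            length I + 3 ≡ ceil3n/4 (4 + (4 + suc m)) → Construction m
fromCheck I {{c}} count =
  record { interiorEdges = I ; seamed = seamedCheck⇒seamed (toWitness c) ; count = count }

-- The interior hyperedges for n = 12, …, 15; vertices 0–3 and 4–7 are the windows.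
construction₁₂ : Construction 3
construction₁₂ = fromCheck (map splitOf
  ( (0 ∷ 1 ∷ 2 ∷ 11 ∷ []) ∷ (0 ∷ 9 ∷ 10 ∷ 11 ∷ []) ∷ (2 ∷ 3 ∷ 8 ∷ 9 ∷ [])
  ∷ (4 ∷ 5 ∷ 10 ∷ 11 ∷ []) ∷ (5 ∷ 6 ∷ 7 ∷ 8 ∷ []) ∷ (7 ∷ 8 ∷ 9 ∷ 10 ∷ []) ∷ [])) refl

construction₁₃ : Construction 4
construction₁₃ = fromCheck (map splitOf
  ( (0 ∷ 1 ∷ 2 ∷ 12 ∷ []) ∷ (0 ∷ 8 ∷ 11 ∷ 12 ∷ []) ∷ (2 ∷ 3 ∷ 8 ∷ 9 ∷ [])
  ∷ (4 ∷ 5 ∷ 10 ∷ 11 ∷ []) ∷ (5 ∷ 6 ∷ 7 ∷ 8 ∷ []) ∷ (7 ∷ 8 ∷ 9 ∷ 10 ∷ [])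
  ∷ (9 ∷ 10 ∷ 11 ∷ 12 ∷ []) ∷ [])) refl

construction₁₄ : Construction 5
construction₁₄ = fromCheck (map splitOf
  ( (0 ∷ 1 ∷ 2 ∷ 13 ∷ []) ∷ (0 ∷ 11 ∷ 12 ∷ 13 ∷ []) ∷ (2 ∷ 3 ∷ 8 ∷ 9 ∷ [])
  ∷ (4 ∷ 5 ∷ 10 ∷ 11 ∷ []) ∷ (5 ∷ 6 ∷ 7 ∷ 8 ∷ []) ∷ (7 ∷ 8 ∷ 9 ∷ 10 ∷ [])
  ∷ (7 ∷ 8 ∷ 12 ∷ 13 ∷ []) ∷ (9 ∷ 10 ∷ 11 ∷ 12 ∷ []) ∷ [])) refl

construction₁₅ : Construction 6
construction₁₅ = fromCheck (map splitOf
  ( (0 ∷ 1 ∷ 2 ∷ 14 ∷ []) ∷ (0 ∷ 8 ∷ 9 ∷ 14 ∷ []) ∷ (2 ∷ 3 ∷ 12 ∷ 13 ∷ [])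
  ∷ (4 ∷ 5 ∷ 10 ∷ 11 ∷ []) ∷ (4 ∷ 7 ∷ 13 ∷ 14 ∷ []) ∷ (5 ∷ 6 ∷ 7 ∷ 8 ∷ [])
  ∷ (7 ∷ 8 ∷ 9 ∷ 10 ∷ []) ∷ (9 ∷ 10 ∷ 11 ∷ 12 ∷ []) ∷ (11 ∷ 12 ∷ 13 ∷ 14 ∷ []) ∷ [])) refl

ceil3n/4-+4 : ∀ n → ceil3n/4 (4 + n) ≡ 3 + ceil3n/4 n
ceil3n/4-+4 n = begin
  (3 * (4 + n) + 3) / 4   ≡⟨ cong (λ t → (t + 3) / 4) (*-distribˡ-+ 3 4 n) ⟩
  (12 + 3 * n + 3) / 4    ≡⟨ cong (_/ 4) (+-assoc 12 (3 * n) 3) ⟩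
  (12 + (3 * n + 3)) / 4  ≡⟨ +-distrib-/-∣ˡ (3 * n + 3) {4} (divides 3 refl) ⟩
  3 + ceil3n/4 n          ∎
  where open ≡-Reasoning

grow-construction : Construction m → Construction (3 + suc m)
grow-construction {m} c = record
  { interiorEdges = grow interiorEdges
  ; seamed        = grow-seamed P₄-uniform seamed
  ; count         = begin
      length (grow interiorEdges) + 3              ≡⟨ cong (_+ 3) (length-grow interiorEdges) ⟩
      length interiorEdges + 3 + 3                 ≡⟨ cong (_+ 3) count ⟩
      ceil3n/4 (4 + (4 + suc m)) + 3               ≡⟨ +-comm _ 3 ⟩
      3 + ceil3n/4 (4 + (4 + suc m))               ≡⟨ sym (ceil3n/4-+4 (4 + (4 + suc m))) ⟩
      ceil3n/4 (4 + (4 + (4 + suc m)))             ∎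
  }
  where
  open Construction c
  open ≡-Reasoning

construction : ∀ k → Construction (3 + k)
construction 0                         = construction₁₂
construction 1                         = construction₁₃
construction 2                         = construction₁₄
construction 3                         = construction₁₅
construction (suc (suc (suc (suc k)))) = grow-construction (construction k)

Optimal : ℕ → Set
Optimal n = Σ (Hypergraph n) λ H → IsUniform 4 H × EIisCycle H × numEdges H ≡ ceil3n/4 n

optimal : ∀ n → 12 ≤ n → Optimal n
optimal n 12≤n = subst Optimal (m+[n∸m]≡n 12≤n) (toOptimal (construction (n ∸ 12)))
  where
  toOptimal : Construction m → Optimal (4 + (4 + suc m))
  toOptimal c = toHypergraph seamed , toHypergraph-uniform P₄-uniform seamed ,
                toHypergraph-eiIsCycle seamed , trans (numEdges-toHypergraph seamed) count
    where open Construction c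

-- The lower bound

prev : Fin (suc k) → Fin (suc k)
prev zero    = fromℕ _
prev (suc i) = inject₁ i

cycSucc-prev : (v : Fin (suc k)) → CycSucc (prev v) v
cycSucc-prev {k} zero    = inj₂ (toℕ-fromℕ k , refl)
cycSucc-prev     (suc i) = inj₁ (cong suc (sym (toℕ-inject₁ i)))

next : Fin (suc k) → Fin (suc k)
next {k} v with k ≟ toℕ v
... | yes _   = zero
... | no  k≢v = suc (lower₁ v k≢v)

cycSucc-next : (v : Fin (suc k)) → CycSucc v (next v)
cycSucc-next {k} v with k ≟ toℕ v
... | yes k≡v = inj₂ (sym k≡v , refl)
... | no  k≢v = inj₁ (cong suc (toℕ-lower₁ v k≢v))

2+n≢n : suc (suc n) ≢ n
2+n≢n {zero}  ()
2+n≢n {suc n} eq = 2+n≢n {n} (cong pred eq)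

cycSucc⇒≢ : ∀ {u v : Fin n} → 2 ≤ n → CycSucc u v → v ≢ u
cycSucc⇒≢ _               (inj₁ eq) refl = 1+n≢n (sym eq)
cycSucc⇒≢ (s≤s (s≤s _)) (inj₂ (eq₁ , eq₂)) refl with trans (sym eq₁) eq₂
... | ()

cycSucc²⇒≢ : ∀ {p v s : Fin n} → 3 ≤ n → CycSucc p v → CycSucc v s → s ≢ p
cycSucc²⇒≢ _ (inj₁ eq₁) (inj₁ eq₂) refl = 2+n≢n (sym (trans eq₂ (cong suc eq₁)))
cycSucc²⇒≢ (s≤s (s≤s (s≤s _))) (inj₁ eq₁) (inj₂ (eq₂ , eq₃)) refl
  with trans (sym eq₂) (trans eq₁ (cong suc eq₃))
... | ()
cycSucc²⇒≢ (s≤s (s≤s (s≤s _))) (inj₂ (eq₁ , eq₂)) (inj₁ eq₃) refl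
  with trans (sym eq₁) (trans eq₃ (cong suc eq₂))
... | ()
cycSucc²⇒≢ (s≤s (s≤s (s≤s _))) (inj₂ (_ , eq₁)) (inj₂ (eq₂ , _)) refl
  with trans (sym eq₂) eq₁
... | ()

consecutive-cycleEdges-≢ : ∀ {p v s : Fin n} → 3 ≤ n → CycSucc p v → CycSucc v s →
                           ⁅ v ⁆ ∪ ⁅ s ⁆ ≢ ⁅ p ⁆ ∪ ⁅ v ⁆
consecutive-cycleEdges-≢ {s = s} 3≤n pv vs eq
  with x∈p∪q⁻ _ _ (subst (s ∈ˢ_) eq (x∈p∪q⁺ (inj₂ (x∈⁅x⁆ s))))
... | inj₁ s∈⁅p⁆ = cycSucc²⇒≢ 3≤n pv vs (x∈⁅y⁆⇒x≡y _ s∈⁅p⁆)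
... | inj₂ s∈⁅v⁆ = cycSucc⇒≢ (≤-trans (s≤s (s≤s z≤n)) 3≤n) vs (x∈⁅y⁆⇒x≡y _ s∈⁅v⁆)

bit : Side → ℕ
bit inside  = 1
bit outside = 0

degree : List (Subset n) → Fin n → ℕ
degree []      _ = 0
degree (e ∷ E) v = bit (lookup e v) + degree E v

∣∣≡∑bit : (e : Subset n) → ∣ e ∣ ≡ ∑ (bit ∘ lookup e)
∣∣≡∑bit []            = refl
∣∣≡∑bit (inside ∷ e)  = cong suc (∣∣≡∑bit e)
∣∣≡∑bit (outside ∷ e) = ∣∣≡∑bit e

∑-degree : (E : List (Subset n)) → All (λ e → ∣ e ∣ ≡ k) E → ∑ (degree E) ≡ length E * k
∑-degree {n} []      []          = sum-replicate-zero n
∑-degree     (e ∷ E) (∣e∣ ∷ ∣E∣) = trans (∑-distrib-+ (bit ∘ lookup e) (degree E))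
                                        (cong₂ _+_ (trans (sym (∣∣≡∑bit e)) ∣e∣) (∑-degree E ∣E∣))

∑-≥ : (f : Fin n → ℕ) → (∀ v → k ≤ f v) → n * k ≤ ∑ f
∑-≥ {zero}  f h = z≤n
∑-≥ {suc n} f h = +-mono-≤ (h zero) (∑-≥ (f ∘ suc) (h ∘ suc))

1≤degree : ∀ {E : List (Subset n)} {e v} → e ∈ E → lookup e v ≡ inside → 1 ≤ degree E v
1≤degree (here refl) eq rewrite eq = s≤s z≤n
1≤degree {E = e′ ∷ _} {v = v} (there e∈) eq = ≤-trans (1≤degree e∈ eq) (m≤n+m _ (bit (lookup e′ v)))

2≤degree : ∀ {E : List (Subset n)} {e f v} → e ∈ E → f ∈ E → e ≢ f →
           lookup e v ≡ inside → lookup f v ≡ inside → 2 ≤ degree E v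
2≤degree (here refl) (here refl) e≢f _  _  = ⊥-elim (e≢f refl)
2≤degree (here refl) (there f∈) _   eq eq′ rewrite eq = s≤s (1≤degree f∈ eq′)
2≤degree (there e∈)  (here refl) _  eq eq′ rewrite eq′ = s≤s (1≤degree e∈ eq)
2≤degree {E = e′ ∷ _} {v = v} (there e∈) (there f∈) e≢f eq eq′ =
  ≤-trans (2≤degree e∈ f∈ e≢f eq eq′) (m≤n+m _ (bit (lookup e′ v)))

3≤degree : ∀ {E : List (Subset n)} {e f g v} → e ∈ E → f ∈ E → g ∈ E → e ≢ f → e ≢ g → f ≢ g →
           lookup e v ≡ inside → lookup f v ≡ inside → lookup g v ≡ inside → 3 ≤ degree E v
3≤degree (here refl) (here refl) _           e≢f _   _   _ _ _ = ⊥-elim (e≢f refl)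
3≤degree (here refl) (there _)   (here refl) _   e≢g _   _ _ _ = ⊥-elim (e≢g refl)
3≤degree (there _)   (here refl) (here refl) _   _   f≢g _ _ _ = ⊥-elim (f≢g refl)
3≤degree (here refl) (there f∈)  (there g∈)  _   _   f≢g e f g rewrite e = s≤s (2≤degree f∈ g∈ f≢g f g)
3≤degree (there e∈)  (here refl) (there g∈)  _   e≢g _   e f g rewrite f = s≤s (2≤degree e∈ g∈ e≢g e g)
3≤degree (there e∈)  (there f∈)  (here refl) e≢f _   _   e f g rewrite g = s≤s (2≤degree e∈ f∈ e≢f e f)
3≤degree {E = e′ ∷ _} {v = v} (there e∈) (there f∈) (there g∈) e≢f e≢g f≢g e f g =
  ≤-trans (3≤degree e∈ f∈ g∈ e≢f e≢g f≢g e f g) (m≤n+m _ (bit (lookup e′ v)))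

distinct-pairs⇒fresh : (e₁ e₂ f₁ f₂ : Subset n) → f₁ ≢ f₂ → f₁ ∩ f₂ ≢ e₁ ∩ e₂ →
                       (f₁ ≢ e₁ × f₁ ≢ e₂) ⊎ (f₂ ≢ e₁ × f₂ ≢ e₂)
distinct-pairs⇒fresh e₁ e₂ f₁ f₂ f₁≢f₂ ∩≢ with f₁ ≟ˢ e₁ | f₁ ≟ˢ e₂ | f₂ ≟ˢ e₁ | f₂ ≟ˢ e₂
... | no f₁≢e₁   | no f₁≢e₂   | _          | _          = inj₁ (f₁≢e₁ , f₁≢e₂)
... | _          | _          | no f₂≢e₁   | no f₂≢e₂   = inj₂ (f₂≢e₁ , f₂≢e₂)
... | yes refl   | _          | yes refl   | _          = ⊥-elim (f₁≢f₂ refl)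
... | _          | yes refl   | _          | yes refl   = ⊥-elim (f₁≢f₂ refl)
... | yes refl   | _          | no _       | yes refl   = ⊥-elim (∩≢ refl)
... | no _       | yes refl   | yes refl   | no _       = ⊥-elim (∩≢ (∩-comm f₁ f₂))

∈-∩⁻ : ∀ {v : Fin n} {s e₁ e₂} → v ∈ˢ s → s ≡ e₁ ∩ e₂ → lookup e₁ v ≡ inside × lookup e₂ v ≡ inside
∈-∩⁻ {e₁ = e₁} {e₂} v∈ refl with x∈p∩q⁻ e₁ e₂ v∈
... | v∈e₁ , v∈e₂ = []=⇒lookup v∈e₁ , []=⇒lookup v∈e₂

degree≥3 : (H : Hypergraph n) → 3 ≤ n → EIisCycle H → ∀ v → 3 ≤ degree (edges H) v
degree≥3 {suc k} H 3≤n ei v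
  with proj₂ (ei _) (prev v , v , cycSucc-prev v , refl)
     | proj₂ (ei _) (v , next v , cycSucc-next v , refl)
... | e₁ , e₂ , e₁∈ , e₂∈ , e₁≢e₂ , eq , _ | f₁ , f₂ , f₁∈ , f₂∈ , f₁≢f₂ , eq′ , _
  with ∈-∩⁻ (x∈p∪q⁺ (inj₂ (x∈⁅x⁆ v))) eq | ∈-∩⁻ (x∈p∪q⁺ (inj₁ (x∈⁅x⁆ v))) eq′
     | distinct-pairs⇒fresh e₁ e₂ f₁ f₂ f₁≢f₂ (λ ∩≡ →
         consecutive-cycleEdges-≢ 3≤n (cycSucc-prev v) (cycSucc-next v)
           (trans eq′ (trans ∩≡ (sym eq))))
... | v∈e₁ , v∈e₂ | v∈f₁ , _ | inj₁ (f₁≢e₁ , f₁≢e₂) =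
  3≤degree e₁∈ e₂∈ f₁∈ e₁≢e₂ (f₁≢e₁ ∘ sym) (f₁≢e₂ ∘ sym) v∈e₁ v∈e₂ v∈f₁
... | v∈e₁ , v∈e₂ | _ , v∈f₂ | inj₂ (f₂≢e₁ , f₂≢e₂) =
  3≤degree e₁∈ e₂∈ f₂∈ e₁≢e₂ (f₂≢e₁ ∘ sym) (f₂≢e₂ ∘ sym) v∈e₁ v∈e₂ v∈f₂

ceil3n/4-least : ∀ n m → n * 3 ≤ m * 4 → ceil3n/4 n ≤ m
ceil3n/4-least n m h = begin
  (3 * n + 3) / 4     ≤⟨ /-monoˡ-≤ 4 (+-monoˡ-≤ 3 (≤-trans (≤-reflexive (*-comm 3 n)) h)) ⟩
  (m * 4 + 3) / 4     ≡⟨ +-distrib-/-∣ˡ 3 {4} (divides m refl) ⟩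
  m * 4 / 4 + 0       ≡⟨ +-identityʳ _ ⟩
  m * 4 / 4           ≡⟨ m*n/n≡m m 4 ⟩
  m                   ∎
  where open ≤-Reasoning

lowerBound : (H : Hypergraph n) → 3 ≤ n → IsUniform 4 H → EIisCycle H → ceil3n/4 n ≤ numEdges H
lowerBound {n} H 3≤n uniform ei = ceil3n/4-least n (numEdges H) (begin
  n * 3                ≤⟨ ∑-≥ (degree (edges H)) (degree≥3 H 3≤n ei) ⟩
  ∑ (degree (edges H)) ≡⟨ ∑-degree (edges H) uniform ⟩
  numEdges H * 4       ∎)
  where open ≤-Reasoning

theorem6 : (n : ℕ) → 12 ≤ n →
    (Σ (Hypergraph n) λ H → IsUniform 4 H × EIisCycle H × numEdges H ≡ ceil3n/4 n)
    × MuIs 4 n (ceil3n/4 n)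
theorem6 n 12≤n = optimal n 12≤n , optimal n 12≤n ,
  λ H uniform ei → lowerBound H (≤-trans (s≤s (s≤s (s≤s z≤n))) 12≤n) uniform ei
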